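{- Let $(u,v)$ be a Hofstadter G pair such that the Zeckendorf representation $\beta$ of $v$ has $\beta_1=1$. Then $\delta(u,v)=-u+\phi^{ -1}v$ satisfies $-\phi^{ -1}<\delta(u,v)<-\phi^{ -3}$.
   Context: $F_0=0$, $F_1=1$, $F_i=F_{i-1}+F_{i-2}$; $\phi=(1+\sqrt5)/2$. For a bit string $\beta=\langle\beta_1\ldots\beta_\ell\rangle$, $\mathrm{FibSum}(\beta)=\sum_{i=1}^\ell\beta_iF_{i+1}$. The Zeckendorf representation of a positive integer $m$ is the unique bit string $\beta$ with $\mathrm{FibSum}(\beta)=m$, $\beta_\ell=1$, and no two consecutive 1s. Hofstadter's G function is $G(x)=\lfloor\phi^{ -1}(x+1)\rfloor$ for integers $x\ge0$. A Hofstadter G pair is a pair $(u,v)$ of positive integers with $u=G(v)$. -}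

module Defs where

open import Data.Nat as ℕ using (ℕ; zero; suc)
open import Data.Integer as ℤ using (ℤ; +_; 0ℤ)
open import Data.Bool using (Bool; true; false; if_then_else_)
open import Data.List using (List; []; _∷_; last)
open import Data.Maybe using (just)
open import Data.Product using (_×_)
open import Data.Sum using (_⊎_)
open import Data.Unit using (⊤)
open import Data.Empty using (⊥)
open import Relation.Binary.PropositionalEquality using (_≡_)

F : ℕ → ℕ
F zero = 0
F (suc zero) = 1
F (suc (suc i)) = F (suc i) ℕ.+ F i

-- Bit strings β = ⟨β₁ … βℓ⟩ are lists of booleans, β₁ first.
-- FibSum β = Σ_{i=1}^{ℓ} β_i F_{i+1}.

fibSumFrom : ℕ → List Bool → ℕ
fibSumFrom k [] = 0
fibSumFrom k (b ∷ bs) = (if b then F k else 0) ℕ.+ fibSumFrom (suc k) bs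

FibSum : List Bool → ℕ
FibSum β = fibSumFrom 2 β

NoConsecutiveOnes : List Bool → Set
NoConsecutiveOnes [] = ⊤
NoConsecutiveOnes (b ∷ []) = ⊤
NoConsecutiveOnes (true ∷ true ∷ bs) = ⊥
NoConsecutiveOnes (true ∷ false ∷ bs) = NoConsecutiveOnes (false ∷ bs)
NoConsecutiveOnes (false ∷ b ∷ bs) = NoConsecutiveOnes (b ∷ bs)

IsZeckendorf : ℕ → List Bool → Set
IsZeckendorf m β = (FibSum β ≡ m) × (last β ≡ just true) × NoConsecutiveOnes β

-- The ring ℤ[φ] = { a + b φ | a b : ℤ }, element mkφ a b = a + bφ, φ = (1+√5)/2, φ² = φ + 1.
-- This is an exact model of the real numbers occurring in the statement.

record ℤφ : Set where
  constructor mkφ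
  field
    re : ℤ
    ph : ℤ
open ℤφ public

infixl 6 _⊕_ _⊖_
infixl 7 _⊗_

_⊕_ : ℤφ → ℤφ → ℤφ
mkφ a b ⊕ mkφ c d = mkφ (a ℤ.+ c) (b ℤ.+ d)

⊝_ : ℤφ → ℤφ
⊝ mkφ a b = mkφ (ℤ.- a) (ℤ.- b)

_⊖_ : ℤφ → ℤφ → ℤφ
x ⊖ y = x ⊕ (⊝ y)

_⊗_ : ℤφ → ℤφ → ℤφ
mkφ a b ⊗ mkφ c d = mkφ (a ℤ.* c ℤ.+ b ℤ.* d) (a ℤ.* d ℤ.+ b ℤ.* c ℤ.+ b ℤ.* d)

fromℤ : ℤ → ℤφ
fromℤ a = mkφ a 0ℤ

fromℕ : ℕ → ℤφ
fromℕ n = fromℤ (+ n)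

φ : ℤφ
φ = mkφ 0ℤ (+ 1)

-- φ⁻¹ = φ - 1 (indeed φ ⊗ φ⁻¹ = 1 since φ² = φ + 1)
φ⁻¹ : ℤφ
φ⁻¹ = mkφ (ℤ.- (+ 1)) (+ 1)

φ⁻³ : ℤφ
φ⁻³ = φ⁻¹ ⊗ φ⁻¹ ⊗ φ⁻¹

-- Sign of a real number.  a + bφ = (p + q√5)/2 with p = 2a + b, q = b.
-- p + q√5 > 0 iff one of the following (√5 irrational, 5 q² vs p²):
PosSurd : ℤ → ℤ → Set
PosSurd p q =
     (0ℤ ℤ.< p × 0ℤ ℤ.≤ q)
  ⊎ ((0ℤ ℤ.≤ p × 0ℤ ℤ.< q)
  ⊎ ((0ℤ ℤ.< p × (q ℤ.< 0ℤ × (+ 5) ℤ.* (q ℤ.* q) ℤ.< p ℤ.* p))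
  ⊎  (p ℤ.< 0ℤ × (0ℤ ℤ.< q × p ℤ.* p ℤ.< (+ 5) ℤ.* (q ℤ.* q)))))

Positive : ℤφ → Set
Positive (mkφ a b) = PosSurd ((+ 2) ℤ.* a ℤ.+ b) b

infix 4 _<ᵣ_ _≤ᵣ_

_<ᵣ_ : ℤφ → ℤφ → Set
x <ᵣ y = Positive (y ⊖ x)

_≤ᵣ_ : ℤφ → ℤφ → Set
x ≤ᵣ y = (x <ᵣ y) ⊎ (x ≡ y)

-- Hofstadter G: G x = ⌊ φ⁻¹ (x + 1) ⌋, expressed as the floor relation
-- IsG x k  :⇔  k ≤ φ⁻¹(x+1) < k + 1.

IsG : ℕ → ℕ → Set
IsG x k = (fromℕ k ≤ᵣ φ⁻¹ ⊗ fromℕ (suc x)) × (φ⁻¹ ⊗ fromℕ (suc x) <ᵣ fromℕ (suc k))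

IsHofstadterGPair : ℕ → ℕ → Set
IsHofstadterGPair u v = (0 ℕ.< u) × (0 ℕ.< v) × IsG v u

δ : ℕ → ℕ → ℤφ
δ u v = (⊝ fromℕ u) ⊕ (φ⁻¹ ⊗ fromℕ v)

{-# OPTIONS --safe #-}

-- Write v = Σ βᵢ Fᵢ₊₁ and r = Σ βᵢ ψ^(i−1) with ψ = 1 − φ = −φ⁻¹.  Since ψⁿ = Fₙ₊₁ − Fₙ φ we get
-- r = w − z φ with w = Σ βᵢ Fᵢ and z = Σ βᵢ Fᵢ₋₁, hence v = w + z, φ⁻¹ v = w − φ⁻² r and
-- δ(u,v) = (w − u) − φ⁻² r.  Without consecutive ones r stays in (−1, φ), and in (φ⁻¹, φ) when β₁ = 1.
-- Then u < w would contradict φ⁻¹ (v + 1) < u + 1, while u ≥ w and r > φ⁻¹ give δ < −φ⁻³.  The lower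
-- bound is u < φ⁻¹ (v + 1), strict because φ is irrational.  On ℤ[φ] the only order facts needed are
-- that positivity survives adding a nonnegative a + b φ and multiplying by φ⁻¹; both are checked on
-- the sign of p + q √5 with p = 2a + b, q = b.

module Submission where

open import Defs
open import Relation.Binary.PropositionalEquality
open import Data.Nat.Base as ℕ using (ℕ; suc; z≤n)
import Data.Nat.Properties as ℕₚ
open import Algebra.Properties.CommutativeSemigroup ℕₚ.+-commutativeSemigroup
  using () renaming (interchange to +-interchange)
open import Data.Integer.Base
  using (ℤ; +_; 0ℤ; _+_; _*_; -_; _-_; _<_; _≤_; +≤+; +<+; nonNegative; positive)
import Data.Integer.Properties as ℤₚ
open import Data.Integer.Tactic.RingSolver using (solve; solve-∀)
import Tactic.RingSolver as Ring
open import Tactic.RingSolver.Core.AlmostCommutativeRing using (AlmostCommutativeRing)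
open import Algebra.Definitions {A = ℤφ} _≡_ using (Associative; Commutative; LeftIdentity)
open import Algebra.Structures {A = ℤφ} _≡_ using (IsCommutativeMonoid)
open import Algebra.Structures.Biased {A = ℤφ} _≡_ using (isCommutativeMonoidˡ; isCommutativeSemiringˡ)
open import Level using (0ℓ)
open import Data.Bool.Base using (Bool; true; false; if_then_else_)
open import Data.List.Base using (List; []; _∷_; head)
open import Data.Maybe.Base using (just; nothing)
open import Data.Product.Base using (_×_; _,_)
open import Data.Sum.Base using (_⊎_; inj₁; inj₂; [_,_]′)
open import Data.Unit.Base using (tt)
open import Function.Base using (id)
open import Relation.Nullary.Negation using (¬_; contradiction)
open import Relation.Nullary.Decidable using (yes; no)
open import Relation.Binary.Definitions using (tri<; tri≈; tri>)

private variable
  i j k l p q : ℤ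

i*i≤j*j : 0ℤ ≤ i → i ≤ j → i * i ≤ j * j
i*i≤j*j {i} {j} 0≤i i≤j = ℤₚ.≤-trans
  (ℤₚ.*-monoˡ-≤-nonNeg i {{nonNegative 0≤i}} i≤j)
  (ℤₚ.*-monoʳ-≤-nonNeg j {{nonNegative (ℤₚ.≤-trans 0≤i i≤j)}} i≤j)

i*i<j*j : 0ℤ ≤ i → i < j → i * i < j * j
i*i<j*j {i} {j} 0≤i i<j = ℤₚ.≤-<-trans
  (ℤₚ.*-monoˡ-≤-nonNeg i {{nonNegative 0≤i}} (ℤₚ.<⇒≤ i<j))
  (ℤₚ.*-monoʳ-<-pos j {{positive (ℤₚ.≤-<-trans 0≤i i<j)}} i<j)

-i*-i≡i*i : ∀ i → - i * - i ≡ i * i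
-i*-i≡i*i = solve-∀

i≤j≤0⇒j*j≤i*i : i ≤ j → j ≤ 0ℤ → j * j ≤ i * i
i≤j≤0⇒j*j≤i*i {i} {j} i≤j j≤0 = subst₂ _≤_ (-i*-i≡i*i j) (-i*-i≡i*i i)
  (i*i≤j*j (ℤₚ.neg-mono-≤ j≤0) (ℤₚ.neg-mono-≤ i≤j))

0≤i*i : ∀ i → 0ℤ ≤ i * i
0≤i*i i with ℤₚ.≤-total 0ℤ i
... | inj₁ 0≤i = i*i≤j*j ℤₚ.≤-refl 0≤i
... | inj₂ i≤0 = i≤j≤0⇒j*j≤i*i i≤0 ℤₚ.≤-refl

i*i≤5*[i*i] : ∀ i → i * i ≤ + 5 * (i * i)
i*i≤5*[i*i] i = begin
  i * i         ≡⟨ solve (i ∷ []) ⟩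
  + 1 * (i * i) ≤⟨ ℤₚ.*-monoʳ-≤-nonNeg (i * i) {{nonNegative (0≤i*i i)}} {+ 1} {+ 5} (+≤+ (ℕ.s≤s z≤n)) ⟩
  + 5 * (i * i) ∎
  where open ℤₚ.≤-Reasoning

5*[i*i]≤[5*i]*[5*i] : ∀ i → + 5 * (i * i) ≤ (+ 5 * i) * (+ 5 * i)
5*[i*i]≤[5*i]*[5*i] i = begin
  + 5 * (i * i)         ≤⟨ ℤₚ.*-monoʳ-≤-nonNeg (i * i) {{nonNegative (0≤i*i i)}} {+ 5} {+ 25} (+≤+ (ℕₚ.m≤m+n 5 20)) ⟩
  + 25 * (i * i)        ≡⟨ solve (i ∷ []) ⟩
  (+ 5 * i) * (+ 5 * i) ∎
  where open ℤₚ.≤-Reasoning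

i+j≡k+l⇒j<l⇒k<i : i + j ≡ k + l → j < l → k < i
i+j≡k+l⇒j<l⇒k<i {i} {j} {k} {l} eq j<l = begin-strict
  k           ≡⟨ solve (k ∷ j ∷ []) ⟩
  k + (j - j) <⟨ ℤₚ.+-monoʳ-< k (ℤₚ.+-monoˡ-< (- j) j<l) ⟩
  k + (l - j) ≡⟨ solve (k ∷ l ∷ j ∷ []) ⟩
  (k + l) - j ≡⟨ cong (_- j) (sym eq) ⟩
  (i + j) - j ≡⟨ solve (i ∷ j ∷ []) ⟩
  i           ∎
  where open ℤₚ.≤-Reasoning

-- Signs of p + q √5

PosSurd-monoˡ : 0ℤ ≤ i → PosSurd p q → PosSurd (p + i) q
PosSurd-monoˡ 0≤i (inj₁ (0<p , 0≤q)) = inj₁ (ℤₚ.+-mono-<-≤ 0<p 0≤i , 0≤q)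
PosSurd-monoˡ 0≤i (inj₂ (inj₁ (0≤p , 0<q))) = inj₂ (inj₁ (ℤₚ.+-mono-≤ 0≤p 0≤i , 0<q))
PosSurd-monoˡ {i} {p} 0≤i (inj₂ (inj₂ (inj₁ (0<p , q<0 , 5q²<p²)))) =
  inj₂ (inj₂ (inj₁ (ℤₚ.+-mono-<-≤ 0<p 0≤i , q<0 ,
    ℤₚ.<-≤-trans 5q²<p² (i*i≤j*j (ℤₚ.<⇒≤ 0<p) (ℤₚ.i≤i+j p i {{nonNegative 0≤i}})))))
PosSurd-monoˡ {i} {p} 0≤i (inj₂ (inj₂ (inj₂ (p<0 , 0<q , p²<5q²)))) with p + i ℤₚ.<? 0ℤ
... | yes p+i<0 = inj₂ (inj₂ (inj₂ (p+i<0 , 0<q ,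
  ℤₚ.≤-<-trans (i≤j≤0⇒j*j≤i*i (ℤₚ.i≤i+j p i {{nonNegative 0≤i}}) (ℤₚ.<⇒≤ p+i<0)) p²<5q²)))
... | no p+i≮0 = inj₂ (inj₁ (ℤₚ.≮⇒≥ p+i≮0 , 0<q))

PosSurd-monoʳ : 0ℤ ≤ j → PosSurd p q → PosSurd p (q + j)
PosSurd-monoʳ 0≤j (inj₁ (0<p , 0≤q)) = inj₁ (0<p , ℤₚ.+-mono-≤ 0≤q 0≤j)
PosSurd-monoʳ 0≤j (inj₂ (inj₁ (0≤p , 0<q))) = inj₂ (inj₁ (0≤p , ℤₚ.+-mono-<-≤ 0<q 0≤j))
PosSurd-monoʳ {j} {p} {q} 0≤j (inj₂ (inj₂ (inj₁ (0<p , q<0 , 5q²<p²)))) with q + j ℤₚ.<? 0ℤ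
... | yes q+j<0 = inj₂ (inj₂ (inj₁ (0<p , q+j<0 , ℤₚ.≤-<-trans
  (ℤₚ.*-monoˡ-≤-nonNeg (+ 5) (i≤j≤0⇒j*j≤i*i (ℤₚ.i≤i+j q j {{nonNegative 0≤j}}) (ℤₚ.<⇒≤ q+j<0)))
  5q²<p²)))
... | no q+j≮0 = inj₁ (0<p , ℤₚ.≮⇒≥ q+j≮0)
PosSurd-monoʳ {j} {p} {q} 0≤j (inj₂ (inj₂ (inj₂ (p<0 , 0<q , p²<5q²)))) =
  inj₂ (inj₂ (inj₂ (p<0 , ℤₚ.+-mono-<-≤ 0<q 0≤j , ℤₚ.<-≤-trans p²<5q²
    (ℤₚ.*-monoˡ-≤-nonNeg (+ 5) (i*i≤j*j (ℤₚ.<⇒≤ 0<q) (ℤₚ.i≤i+j q j {{nonNegative 0≤j}}))))))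

PosSurd′ : ℤ → ℤ → Set
PosSurd′ p q = (0ℤ < p × (0ℤ ≤ q ⊎ + 5 * (q * q) < p * p))
             ⊎ (0ℤ < q × (0ℤ ≤ p ⊎ p * p < + 5 * (q * q)))

PosSurd⇒PosSurd′ : PosSurd p q → PosSurd′ p q
PosSurd⇒PosSurd′ (inj₁ (0<p , 0≤q)) = inj₁ (0<p , inj₁ 0≤q)
PosSurd⇒PosSurd′ (inj₂ (inj₁ (0≤p , 0<q))) = inj₂ (0<q , inj₁ 0≤p)
PosSurd⇒PosSurd′ (inj₂ (inj₂ (inj₁ (0<p , _ , 5q²<p²)))) = inj₁ (0<p , inj₂ 5q²<p²)
PosSurd⇒PosSurd′ (inj₂ (inj₂ (inj₂ (_ , 0<q , p²<5q²)))) = inj₂ (0<q , inj₂ p²<5q²)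

PosSurd′-asym : PosSurd′ p q → ¬ PosSurd′ (- p) (- q)
PosSurd′-asym {p} {q} = λ where
    (inj₁ (0<p , _)) (inj₁ (0<-p , _)) → 0<i⇒0≮-i 0<p 0<-p
    (inj₁ (0<p , _)) (inj₂ (_ , inj₁ 0≤-p)) → 0<i⇒0≰-i 0<p 0≤-p
    (inj₁ (_ , inj₁ 0≤q)) (inj₂ (0<-q , inj₂ _)) → 0≤i⇒0≮-i 0≤q 0<-q
    (inj₁ (_ , inj₂ 5q²<p²)) (inj₂ (_ , inj₂ p²<5q²)) →
      ℤₚ.<-asym 5q²<p² (subst₂ _<_ -p² -5q² p²<5q²)
    (inj₂ (0<q , _)) (inj₂ (0<-q , _)) → 0<i⇒0≮-i 0<q 0<-q
    (inj₂ (0<q , _)) (inj₁ (_ , inj₁ 0≤-q)) → 0<i⇒0≰-i 0<q 0≤-q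
    (inj₂ (_ , inj₁ 0≤p)) (inj₁ (0<-p , inj₂ _)) → 0≤i⇒0≮-i 0≤p 0<-p
    (inj₂ (_ , inj₂ p²<5q²)) (inj₁ (_ , inj₂ 5q²<p²)) →
      ℤₚ.<-asym p²<5q² (subst₂ _<_ -5q² -p² 5q²<p²)
  where
  0<i⇒0≮-i : 0ℤ < i → ¬ 0ℤ < - i
  0<i⇒0≮-i 0<i 0<-i = ℤₚ.<-asym 0<i (ℤₚ.neg-cancel-< 0<-i)
  0≤i⇒0≮-i : 0ℤ ≤ i → ¬ 0ℤ < - i
  0≤i⇒0≮-i 0≤i 0<-i = ℤₚ.<⇒≱ (ℤₚ.neg-cancel-< 0<-i) 0≤i
  0<i⇒0≰-i : 0ℤ < i → ¬ 0ℤ ≤ - i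
  0<i⇒0≰-i 0<i 0≤-i = ℤₚ.<⇒≱ 0<i (ℤₚ.neg-cancel-≤ 0≤-i)
  -p² : - p * - p ≡ p * p
  -p² = -i*-i≡i*i p
  -5q² : + 5 * (- q * - q) ≡ + 5 * (q * q)
  -5q² = cong (+ 5 *_) (-i*-i≡i*i q)

PosSurd-asym : PosSurd p q → ¬ PosSurd (- p) (- q)
PosSurd-asym pos neg = PosSurd′-asym (PosSurd⇒PosSurd′ pos) (PosSurd⇒PosSurd′ neg)

-- (p′ + a √5)/2 = φ⁻¹ (p + b √5)/2 for p = 2a + b and p′ = 2(b − a) + a; the norm changes sign.
norm-flip : ∀ a b → (+ 2 * (b - a) + a) * (+ 2 * (b - a) + a) + (+ 2 * a + b) * (+ 2 * a + b)
                  ≡ + 5 * (a * a) + + 5 * (b * b)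
norm-flip = solve-∀

module _ (a b : ℤ) where
  open ℤₚ.≤-Reasoning

  private
    PosSurd-φ⁻¹-nonNeg : 0ℤ ≤ + 2 * a + b → 0ℤ ≤ b → 0ℤ < + 2 * a + b ⊎ 0ℤ < b →
                         PosSurd (+ 2 * (b - a) + a) a
    PosSurd-φ⁻¹-nonNeg 0≤p 0≤b 0<p∨0<b with ℤₚ.<-cmp a 0ℤ
    ... | tri< a<0 _ _ = inj₂ (inj₂ (inj₁ (0<p′ , a<0 ,
          i+j≡k+l⇒j<l⇒k<i (norm-flip a b) (ℤₚ.<-≤-trans p²<b² (i*i≤5*[i*i] b)))))
      where
      0<-a : 0ℤ < - a
      0<-a = ℤₚ.neg-mono-< a<0
      0<p′ : 0ℤ < + 2 * (b - a) + a
      0<p′ = begin-strict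
        0ℤ             <⟨ ℤₚ.+-mono-≤-< (ℤₚ.+-mono-≤ 0≤b 0≤b) 0<-a ⟩
        (b + b) + - a  ≡⟨ solve (a ∷ b ∷ []) ⟩
        + 2 * (b - a) + a ∎
      p<b : + 2 * a + b < b
      p<b = begin-strict
        + 2 * a + b                      ≡⟨ solve (a ∷ b ∷ []) ⟩
        + 2 * a + b + 0ℤ                 <⟨ ℤₚ.+-monoʳ-< (+ 2 * a + b) (ℤₚ.+-mono-< 0<-a 0<-a) ⟩
        + 2 * a + b + (- a + - a)        ≡⟨ solve (a ∷ b ∷ []) ⟩
        b                                ∎
      p²<b² : (+ 2 * a + b) * (+ 2 * a + b) < b * b
      p²<b² = i*i<j*j 0≤p p<b
    ... | tri≈ _ refl _ = inj₁ (0<p′ , ℤₚ.≤-refl)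
      where
      0<b : 0ℤ < b
      0<b = [ (λ 0<p → begin-strict 0ℤ <⟨ 0<p ⟩ + 2 * 0ℤ + b ≡⟨ solve (b ∷ []) ⟩ b ∎) , id ]′
              0<p∨0<b
      0<p′ : 0ℤ < + 2 * (b - 0ℤ) + 0ℤ
      0<p′ = begin-strict
        0ℤ                    <⟨ ℤₚ.+-mono-< 0<b 0<b ⟩
        b + b                 ≡⟨ solve (b ∷ []) ⟩
        + 2 * (b - 0ℤ) + 0ℤ   ∎
    ... | tri> _ _ 0<a with 0ℤ ℤₚ.≤? + 2 * (b - a) + a
    ...   | yes 0≤p′ = inj₂ (inj₁ (0≤p′ , 0<a))
    ...   | no 0≰p′ = inj₂ (inj₂ (inj₂ (p′<0 , 0<a ,
            i+j≡k+l⇒j<l⇒k<i (sym (norm-flip a b)) (ℤₚ.≤-<-trans (5*[i*i]≤[5*i]*[5*i] b) [5b]²<p²))))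
      where
      p′<0 : + 2 * (b - a) + a < 0ℤ
      p′<0 = ℤₚ.≰⇒> 0≰p′
      0<-p′ : 0ℤ < - (+ 2 * (b - a) + a)
      0<-p′ = ℤₚ.neg-mono-< p′<0
      5b<p : + 5 * b < + 2 * a + b
      5b<p = begin-strict
        + 5 * b                  ≡⟨ solve (b ∷ []) ⟩
        + 5 * b + 0ℤ             <⟨ ℤₚ.+-monoʳ-< (+ 5 * b) (ℤₚ.+-mono-< 0<-p′ 0<-p′) ⟩
        + 5 * b + (- (+ 2 * (b - a) + a) + - (+ 2 * (b - a) + a)) ≡⟨ solve (a ∷ b ∷ []) ⟩
        + 2 * a + b              ∎
      [5b]²<p² : (+ 5 * b) * (+ 5 * b) < (+ 2 * a + b) * (+ 2 * a + b)
      [5b]²<p² = i*i<j*j (ℤₚ.*-monoˡ-≤-nonNeg (+ 5) 0≤b) 5b<p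

  PosSurd-φ⁻¹ : PosSurd (+ 2 * a + b) b → PosSurd (+ 2 * (b - a) + a) a
  PosSurd-φ⁻¹ (inj₁ (0<p , 0≤b)) = PosSurd-φ⁻¹-nonNeg (ℤₚ.<⇒≤ 0<p) 0≤b (inj₁ 0<p)
  PosSurd-φ⁻¹ (inj₂ (inj₁ (0≤p , 0<b))) = PosSurd-φ⁻¹-nonNeg 0≤p (ℤₚ.<⇒≤ 0<b) (inj₂ 0<b)
  PosSurd-φ⁻¹ (inj₂ (inj₂ (inj₁ (0<p , b<0 , 5b²<p²)))) =
    inj₂ (inj₂ (inj₂ (p′<0 , 0<a , i+j≡k+l⇒j<l⇒k<i (sym (norm-flip a b)) 5b²<p²)))
    where
    0<-b : 0ℤ < - b
    0<-b = ℤₚ.neg-mono-< b<0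
    0<a : 0ℤ < a
    0<a = ℤₚ.*-cancelˡ-<-nonNeg (+ 2) (begin-strict
      0ℤ              <⟨ ℤₚ.+-mono-< 0<p 0<-b ⟩
      + 2 * a + b + - b ≡⟨ solve (a ∷ b ∷ []) ⟩
      + 2 * a         ∎)
    p′<0 : + 2 * (b - a) + a < 0ℤ
    p′<0 = ℤₚ.neg-cancel-< (begin-strict
      0ℤ                            <⟨ ℤₚ.+-mono-< 0<a (ℤₚ.+-mono-< 0<-b 0<-b) ⟩
      a + (- b + - b)               ≡⟨ solve (a ∷ b ∷ []) ⟩
      - (+ 2 * (b - a) + a)         ∎)
  PosSurd-φ⁻¹ (inj₂ (inj₂ (inj₂ (p<0 , 0<b , p²<5b²)))) =
    inj₂ (inj₂ (inj₁ (0<p′ , a<0 , i+j≡k+l⇒j<l⇒k<i (norm-flip a b) p²<5b²)))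
    where
    a<0 : a < 0ℤ
    a<0 = ℤₚ.*-cancelˡ-<-nonNeg (+ 2) (begin-strict
      + 2 * a             ≡⟨ solve (a ∷ b ∷ []) ⟩
      + 2 * a + b + - b   <⟨ ℤₚ.+-mono-< p<0 (ℤₚ.neg-mono-< 0<b) ⟩
      0ℤ                  ∎)
    0<p′ : 0ℤ < + 2 * (b - a) + a
    0<p′ = begin-strict
      0ℤ              <⟨ ℤₚ.+-mono-< (ℤₚ.+-mono-< 0<b 0<b) (ℤₚ.neg-mono-< a<0) ⟩
      (b + b) + - a   ≡⟨ solve (a ∷ b ∷ []) ⟩
      + 2 * (b - a) + a ∎

⊕-assoc : ∀ x y z → (x ⊕ y) ⊕ z ≡ x ⊕ (y ⊕ z)
⊕-assoc (mkφ a b) (mkφ c d) (mkφ e f) = cong₂ mkφ (ℤₚ.+-assoc a c e) (ℤₚ.+-assoc b d f)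

⊕-comm : ∀ x y → x ⊕ y ≡ y ⊕ x
⊕-comm (mkφ a b) (mkφ c d) = cong₂ mkφ (ℤₚ.+-comm a c) (ℤₚ.+-comm b d)

⊕-identityˡ : ∀ x → fromℕ 0 ⊕ x ≡ x
⊕-identityˡ (mkφ a b) = cong₂ mkφ (ℤₚ.+-identityˡ a) (ℤₚ.+-identityˡ b)

⊝-distrib-⊕ : ∀ x y → (⊝ x) ⊕ (⊝ y) ≡ ⊝ (x ⊕ y)
⊝-distrib-⊕ (mkφ a b) (mkφ c d) =
  cong₂ mkφ (sym (ℤₚ.neg-distrib-+ a c)) (sym (ℤₚ.neg-distrib-+ b d))

⊗-assoc : ∀ x y z → (x ⊗ y) ⊗ z ≡ x ⊗ (y ⊗ z)
⊗-assoc (mkφ a b) (mkφ c d) (mkφ e f) = cong₂ mkφ (re≡ a b c d e f) (ph≡ a b c d e f)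
  where
  re≡ : ∀ a b c d e f → (a * c + b * d) * e + (a * d + b * c + b * d) * f
                      ≡ a * (c * e + d * f) + b * (c * f + d * e + d * f)
  re≡ = solve-∀
  ph≡ : ∀ a b c d e f →
        (a * c + b * d) * f + (a * d + b * c + b * d) * e + (a * d + b * c + b * d) * f
      ≡ a * (c * f + d * e + d * f) + b * (c * e + d * f) + b * (c * f + d * e + d * f)
  ph≡ = solve-∀

⊗-comm : ∀ x y → x ⊗ y ≡ y ⊗ x
⊗-comm (mkφ a b) (mkφ c d) = cong₂ mkφ (re≡ a b c d) (ph≡ a b c d)
  where
  re≡ : ∀ a b c d → a * c + b * d ≡ c * a + d * b
  re≡ = solve-∀
  ph≡ : ∀ a b c d → a * d + b * c + b * d ≡ c * b + d * a + d * b
  ph≡ = solve-∀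

⊗-identityˡ : ∀ x → fromℕ 1 ⊗ x ≡ x
⊗-identityˡ (mkφ a b) = cong₂ mkφ (re≡ a b) (ph≡ a b)
  where
  re≡ : ∀ a b → + 1 * a + 0ℤ * b ≡ a
  re≡ = solve-∀
  ph≡ : ∀ a b → + 1 * b + 0ℤ * a + 0ℤ * b ≡ b
  ph≡ = solve-∀

⊗-zeroˡ : ∀ x → fromℕ 0 ⊗ x ≡ fromℕ 0
⊗-zeroˡ (mkφ a b) = cong₂ mkφ (re≡ a b) (ph≡ a b)
  where
  re≡ : ∀ a b → 0ℤ * a + 0ℤ * b ≡ 0ℤ
  re≡ = solve-∀
  ph≡ : ∀ a b → 0ℤ * b + 0ℤ * a + 0ℤ * b ≡ 0ℤ
  ph≡ = solve-∀

⊗-distribʳ-⊕ : ∀ x y z → (y ⊕ z) ⊗ x ≡ (y ⊗ x) ⊕ (z ⊗ x)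
⊗-distribʳ-⊕ (mkφ a b) (mkφ c d) (mkφ e f) = cong₂ mkφ (re≡ a b c d e f) (ph≡ a b c d e f)
  where
  re≡ : ∀ a b c d e f → (c + e) * a + (d + f) * b ≡ (c * a + d * b) + (e * a + f * b)
  re≡ = solve-∀
  ph≡ : ∀ a b c d e f → (c + e) * b + (d + f) * a + (d + f) * b
                      ≡ (c * b + d * a + d * b) + (e * b + f * a + f * b)
  ph≡ = solve-∀

⊝-distribˡ-⊗ : ∀ x y → (⊝ x) ⊗ y ≡ ⊝ (x ⊗ y)
⊝-distribˡ-⊗ (mkφ a b) (mkφ c d) = cong₂ mkφ (re≡ a b c d) (ph≡ a b c d)
  where
  re≡ : ∀ a b c d → - a * c + - b * d ≡ - (a * c + b * d)
  re≡ = solve-∀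
  ph≡ : ∀ a b c d → - a * d + - b * c + - b * d ≡ - (a * d + b * c + b * d)
  ph≡ = solve-∀

-- With this ring the solver proves the identities below although they rely on φ² = φ + 1:
-- every constant in them is closed, so it evaluates to a literal mkφ a b, which is also why
-- recognising zero syntactically suffices.
ℤφ-ring : AlmostCommutativeRing 0ℓ 0ℓ
ℤφ-ring = record
  { Carrier = ℤφ
  ; _≈_     = _≡_
  ; _+_     = _⊕_
  ; _*_     = _⊗_
  ; -_      = ⊝_
  ; 0#      = fromℕ 0
  ; 0≟_     = λ { (mkφ (+ 0) (+ 0)) → just refl ; _ → nothing }
  ; 1#      = fromℕ 1
  ; isAlmostCommutativeRing = record
    { isCommutativeSemiring = isCommutativeSemiringˡ (record
      { +-isCommutativeMonoid = isCommutativeMonoid _⊕_ ⊕-assoc ⊕-identityˡ ⊕-comm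
      ; *-isCommutativeMonoid = isCommutativeMonoid _⊗_ ⊗-assoc ⊗-identityˡ ⊗-comm
      ; distribʳ              = ⊗-distribʳ-⊕
      ; zeroˡ                 = ⊗-zeroˡ
      })
    ; -‿cong       = cong ⊝_
    ; -‿*-distribˡ = ⊝-distribˡ-⊗
    ; -‿+-comm     = ⊝-distrib-⊕
    }
  }
  where
  isCommutativeMonoid : ∀ _∙_ {ε} → Associative _∙_ → LeftIdentity ε _∙_ → Commutative _∙_ →
                        IsCommutativeMonoid _∙_ ε
  isCommutativeMonoid _∙_ assoc identityˡ comm = isCommutativeMonoidˡ (record
    { isSemigroup = record
      { isMagma = record { isEquivalence = isEquivalence ; ∙-cong = cong₂ _∙_ }
      ; assoc   = assoc
      }
    ; identityˡ = identityˡ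
    ; comm      = comm
    })

-- Order on ℤ[φ]

Positive-⊕-nonNeg : 0ℤ ≤ i → 0ℤ ≤ j → ∀ x → Positive x → Positive (mkφ i j ⊕ x)
Positive-⊕-nonNeg {i} {j} 0≤i 0≤j (mkφ a b) pos =
  subst₂ PosSurd p≡ q≡ (PosSurd-monoʳ 0≤j (PosSurd-monoˡ 0≤2i+j pos))
  where
  p≡ : + 2 * a + b + (+ 2 * i + j) ≡ + 2 * (i + a) + (j + b)
  p≡ = solve (i ∷ j ∷ a ∷ b ∷ [])
  q≡ : b + j ≡ j + b
  q≡ = ℤₚ.+-comm b j
  0≤2i+j : 0ℤ ≤ + 2 * i + j
  0≤2i+j = ℤₚ.+-mono-≤ (ℤₚ.*-monoˡ-≤-nonNeg (+ 2) 0≤i) 0≤j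

Positive-φ⁻¹⊗ : ∀ x → Positive x → Positive (φ⁻¹ ⊗ x)
Positive-φ⁻¹⊗ (mkφ a b) pos = subst Positive (cong₂ mkφ (re≡ a b) (ph≡ a b)) (PosSurd-φ⁻¹ a b pos)
  where
  re≡ : ∀ a b → b - a ≡ - (+ 1) * a + + 1 * b
  re≡ = solve-∀
  ph≡ : ∀ a b → a ≡ - (+ 1) * b + + 1 * a + + 1 * b
  ph≡ = solve-∀

Positive-asym : ∀ x → Positive x → ¬ Positive (⊝ x)
Positive-asym (mkφ a b) pos neg = PosSurd-asym pos (subst (λ p → PosSurd p (- b)) p≡ neg)
  where
  p≡ : + 2 * - a + - b ≡ - (+ 2 * a + b)
  p≡ = solve (a ∷ b ∷ [])

<ᵣ-asym : ∀ {x y} → x <ᵣ y → ¬ y <ᵣ x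
<ᵣ-asym {x} {y} x<y y<x = Positive-asym (y ⊖ x) x<y (subst Positive (x-y≡ x y) y<x)
  where
  x-y≡ : ∀ x y → x ⊖ y ≡ ⊝ (y ⊖ x)
  x-y≡ = Ring.solve-∀ ℤφ-ring

infix 4 _∈⟨_,_⟩

_∈⟨_,_⟩ : ℤφ → ℤφ → ℤφ → Set
x ∈⟨ l , u ⟩ = l <ᵣ x × x <ᵣ u

-- The conjugate digit sum Σ βᵢ ψ^(i−1)

ψ : ℤφ
ψ = mkφ (+ 1) (- + 1)

ψSum : List Bool → ℤφ
ψSum []      = fromℕ 0
ψSum (b ∷ β) = fromℕ (if b then 1 else 0) ⊕ ψ ⊗ ψSum β

fibSumFrom-+2 : ∀ k β → fibSumFrom (2 ℕ.+ k) β ≡ fibSumFrom (1 ℕ.+ k) β ℕ.+ fibSumFrom k β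
fibSumFrom-+2 k []          = refl
fibSumFrom-+2 k (false ∷ β) = fibSumFrom-+2 (suc k) β
fibSumFrom-+2 k (true ∷ β)  = begin
  F (2 ℕ.+ k) ℕ.+ fibSumFrom (3 ℕ.+ k) β
    ≡⟨ cong (F (2 ℕ.+ k) ℕ.+_) (fibSumFrom-+2 (suc k) β) ⟩
  (F (1 ℕ.+ k) ℕ.+ F k) ℕ.+ (fibSumFrom (2 ℕ.+ k) β ℕ.+ fibSumFrom (1 ℕ.+ k) β)
    ≡⟨ +-interchange (F (1 ℕ.+ k)) (F k) (fibSumFrom (2 ℕ.+ k) β) (fibSumFrom (1 ℕ.+ k) β) ⟩
  (F (1 ℕ.+ k) ℕ.+ fibSumFrom (2 ℕ.+ k) β) ℕ.+ (F k ℕ.+ fibSumFrom (1 ℕ.+ k) β) ∎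
  where open ≡-Reasoning

ψSum≡fibSums : ∀ β → ψSum β ≡ fromℕ (fibSumFrom 1 β) ⊖ φ ⊗ fromℕ (fibSumFrom 0 β)
ψSum≡fibSums []      = refl
ψSum≡fibSums (b ∷ β) = begin
  fromℕ c ⊕ ψ ⊗ ψSum β                   ≡⟨ cong (λ r → fromℕ c ⊕ ψ ⊗ r) (ψSum≡fibSums β) ⟩
  fromℕ c ⊕ ψ ⊗ (fromℕ w ⊖ φ ⊗ fromℕ z)  ≡⟨ ψ⊗[w−zφ] (fromℕ c) (fromℕ w) (fromℕ z) ⟩
  fromℕ (c ℕ.+ (w ℕ.+ z)) ⊖ φ ⊗ fromℕ w  ≡⟨ cong (λ n → fromℕ (c ℕ.+ n) ⊖ φ ⊗ fromℕ w)
                                                   (sym (fibSumFrom-+2 0 β)) ⟩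
  fromℕ (c ℕ.+ fibSumFrom 2 β) ⊖ φ ⊗ fromℕ w ≡⟨ lowest-digit b ⟩
  fromℕ (fibSumFrom 1 (b ∷ β)) ⊖ φ ⊗ fromℕ (fibSumFrom 0 (b ∷ β)) ∎
  where
  open ≡-Reasoning
  c = if b then 1 else 0
  w = fibSumFrom 1 β
  z = fibSumFrom 0 β
  ψ⊗[w−zφ] : ∀ c w z → c ⊕ ψ ⊗ (w ⊖ φ ⊗ z) ≡ (c ⊕ (w ⊕ z)) ⊖ φ ⊗ w
  ψ⊗[w−zφ] = Ring.solve-∀ ℤφ-ring
  lowest-digit : ∀ b → fromℕ ((if b then 1 else 0) ℕ.+ fibSumFrom 2 β) ⊖ φ ⊗ fromℕ w
                     ≡ fromℕ (fibSumFrom 1 (b ∷ β)) ⊖ φ ⊗ fromℕ (fibSumFrom 0 (b ∷ β))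
  lowest-digit false = refl
  lowest-digit true  = refl

ψ-step-∈ : ∀ x → x ∈⟨ ⊝ fromℕ 1 , φ ⟩ → fromℕ 0 ⊕ ψ ⊗ x ∈⟨ ⊝ fromℕ 1 , φ ⟩
ψ-step-∈ x (−1<x , x<φ) =
  subst Positive (lower x) (Positive-φ⁻¹⊗ (φ ⊖ x) x<φ) ,
  subst Positive (upper x)
    (Positive-⊕-nonNeg (+≤+ z≤n) ℤₚ.≤-refl (φ⁻¹ ⊗ (x ⊖ ⊝ fromℕ 1)) (Positive-φ⁻¹⊗ (x ⊖ ⊝ fromℕ 1) −1<x))
  where
  lower : ∀ x → φ⁻¹ ⊗ (φ ⊖ x) ≡ (fromℕ 0 ⊕ ψ ⊗ x) ⊖ ⊝ fromℕ 1
  lower = Ring.solve-∀ ℤφ-ring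
  upper : ∀ x → fromℕ 1 ⊕ φ⁻¹ ⊗ (x ⊖ ⊝ fromℕ 1) ≡ φ ⊖ (fromℕ 0 ⊕ ψ ⊗ x)
  upper = Ring.solve-∀ ℤφ-ring

ψ²-step-∈ : ∀ x → x ∈⟨ ⊝ fromℕ 1 , φ ⟩ → fromℕ 1 ⊕ ψ ⊗ (fromℕ 0 ⊕ ψ ⊗ x) ∈⟨ φ⁻¹ , φ ⟩
ψ²-step-∈ x (−1<x , x<φ) =
  subst Positive (lower x) (Positive-φ⁻¹⊗ _ (Positive-φ⁻¹⊗ (x ⊖ ⊝ fromℕ 1) −1<x)) ,
  subst Positive (upper x) (Positive-φ⁻¹⊗ _ (Positive-φ⁻¹⊗ (φ ⊖ x) x<φ))
  where
  lower : ∀ x → φ⁻¹ ⊗ (φ⁻¹ ⊗ (x ⊖ ⊝ fromℕ 1)) ≡ (fromℕ 1 ⊕ ψ ⊗ (fromℕ 0 ⊕ ψ ⊗ x)) ⊖ φ⁻¹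
  lower = Ring.solve-∀ ℤφ-ring
  upper : ∀ x → φ⁻¹ ⊗ (φ⁻¹ ⊗ (φ ⊖ x)) ≡ φ ⊖ (fromℕ 1 ⊕ ψ ⊗ (fromℕ 0 ⊕ ψ ⊗ x))
  upper = Ring.solve-∀ ℤφ-ring

∈⟨φ⁻¹,φ⟩⇒∈⟨−1,φ⟩ : ∀ x → x ∈⟨ φ⁻¹ , φ ⟩ → x ∈⟨ ⊝ fromℕ 1 , φ ⟩
∈⟨φ⁻¹,φ⟩⇒∈⟨−1,φ⟩ x (φ⁻¹<x , x<φ) =
  subst Positive (φ+[x−φ⁻¹]≡ x) (Positive-⊕-nonNeg ℤₚ.≤-refl (+≤+ z≤n) (x ⊖ φ⁻¹) φ⁻¹<x) , x<φ
  where
  φ+[x−φ⁻¹]≡ : ∀ x → φ ⊕ (x ⊖ φ⁻¹) ≡ x ⊖ ⊝ fromℕ 1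
  φ+[x−φ⁻¹]≡ = Ring.solve-∀ ℤφ-ring

NoConsecutiveOnes-tail : ∀ {b} β → NoConsecutiveOnes (b ∷ β) → NoConsecutiveOnes β
NoConsecutiveOnes-tail []                 _  = tt
NoConsecutiveOnes-tail {true}  (false ∷ β) nc = nc
NoConsecutiveOnes-tail {false} (_ ∷ β)     nc = nc

mutual
  ψSum-∈ : ∀ β → NoConsecutiveOnes β → ψSum β ∈⟨ ⊝ fromℕ 1 , φ ⟩
  ψSum-∈ []          _  = inj₁ (+<+ ℕ.z<s , +≤+ z≤n) , inj₁ (+<+ ℕ.z<s , +≤+ z≤n)
  ψSum-∈ (false ∷ β) nc = ψ-step-∈ (ψSum β) (ψSum-∈ β (NoConsecutiveOnes-tail β nc))
  ψSum-∈ (true ∷ β)  nc = ∈⟨φ⁻¹,φ⟩⇒∈⟨−1,φ⟩ (ψSum (true ∷ β)) (ψSum-∈-true β nc)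

  ψSum-∈-true : ∀ β → NoConsecutiveOnes (true ∷ β) → ψSum (true ∷ β) ∈⟨ φ⁻¹ , φ ⟩
  -- ψSum ⟨1⟩ = ψSum ⟨1 0⟩ definitionally
  ψSum-∈-true []          _  = ψ²-step-∈ (ψSum []) (ψSum-∈ [] tt)
  ψSum-∈-true (false ∷ β) nc = ψ²-step-∈ (ψSum β) (ψSum-∈ β (NoConsecutiveOnes-tail β nc))

fromℕ≢φ⁻¹⊗fromℕ-suc : ∀ u n → fromℕ u ≢ φ⁻¹ ⊗ fromℕ (suc n)
fromℕ≢φ⁻¹⊗fromℕ-suc u n ()   -- the φ-coefficients are 0 and n + 1

⊝φ⁻¹<δ : ∀ {u v} → fromℕ u ≤ᵣ φ⁻¹ ⊗ fromℕ (suc v) → ⊝ φ⁻¹ <ᵣ δ u v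
⊝φ⁻¹<δ {u} {v} (inj₁ u<φ⁻¹[v+1]) = subst Positive (δ+φ⁻¹≡ (fromℕ u) (fromℕ v)) u<φ⁻¹[v+1]
  where
  δ+φ⁻¹≡ : ∀ u v → φ⁻¹ ⊗ (fromℕ 1 ⊕ v) ⊖ u ≡ ((⊝ u) ⊕ φ⁻¹ ⊗ v) ⊖ ⊝ φ⁻¹
  δ+φ⁻¹≡ = Ring.solve-∀ ℤφ-ring
⊝φ⁻¹<δ {u} {v} (inj₂ u≡φ⁻¹[v+1]) = contradiction u≡φ⁻¹[v+1] (fromℕ≢φ⁻¹⊗fromℕ-suc u v)

-- With r = w − z φ one has φ⁻¹ (w + z) = w − φ⁻² r; the next two lemmas are instances of this.
δ<⊝φ⁻³ : ∀ {u} w z → w ℕ.≤ u → φ⁻¹ <ᵣ fromℕ w ⊖ φ ⊗ fromℕ z → δ u (w ℕ.+ z) <ᵣ ⊝ φ⁻³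
δ<⊝φ⁻³ w z w≤u φ⁻¹<r with ℕₚ.m≤n⇒∃[o]m+o≡n w≤u
... | d , refl = subst Positive (gap≡ (fromℕ w) (fromℕ z) (fromℕ d))
  (Positive-⊕-nonNeg (+≤+ z≤n) ℤₚ.≤-refl (φ⁻¹ ⊗ (φ⁻¹ ⊗ (r ⊖ φ⁻¹)))
    (Positive-φ⁻¹⊗ (φ⁻¹ ⊗ (r ⊖ φ⁻¹)) (Positive-φ⁻¹⊗ (r ⊖ φ⁻¹) φ⁻¹<r)))
  where
  r = fromℕ w ⊖ φ ⊗ fromℕ z
  gap≡ : ∀ w z d → d ⊕ φ⁻¹ ⊗ (φ⁻¹ ⊗ ((w ⊖ φ ⊗ z) ⊖ φ⁻¹)) ≡ (⊝ φ⁻³) ⊖ ((⊝ (w ⊕ d)) ⊕ φ⁻¹ ⊗ (w ⊕ z))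
  gap≡ = Ring.solve-∀ ℤφ-ring

[1+u]<φ⁻¹[v+1] : ∀ {u} w z → u ℕ.< w → fromℕ w ⊖ φ ⊗ fromℕ z <ᵣ φ →
                 fromℕ (suc u) <ᵣ φ⁻¹ ⊗ fromℕ (suc (w ℕ.+ z))
[1+u]<φ⁻¹[v+1] {u} w z u<w r<φ with ℕₚ.m≤n⇒∃[o]m+o≡n u<w
... | d , refl = subst Positive (gap≡ (fromℕ (suc u)) (fromℕ z) (fromℕ d))
  (Positive-⊕-nonNeg (+≤+ z≤n) ℤₚ.≤-refl (φ⁻¹ ⊗ (φ⁻¹ ⊗ (φ ⊖ r)))
    (Positive-φ⁻¹⊗ (φ⁻¹ ⊗ (φ ⊖ r)) (Positive-φ⁻¹⊗ (φ ⊖ r) r<φ)))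
  where
  r = fromℕ (suc u ℕ.+ d) ⊖ φ ⊗ fromℕ z
  gap≡ : ∀ u z d → d ⊕ φ⁻¹ ⊗ (φ⁻¹ ⊗ (φ ⊖ ((u ⊕ d) ⊖ φ ⊗ z))) ≡ φ⁻¹ ⊗ (fromℕ 1 ⊕ ((u ⊕ d) ⊕ z)) ⊖ u
  gap≡ = Ring.solve-∀ ℤφ-ring

δ-∈ : ∀ u w z → fromℕ w ⊖ φ ⊗ fromℕ z ∈⟨ φ⁻¹ , φ ⟩ → IsG (w ℕ.+ z) u →
      δ u (w ℕ.+ z) ∈⟨ ⊝ φ⁻¹ , ⊝ φ⁻³ ⟩
δ-∈ u w z (φ⁻¹<r , r<φ) (G≥ , G<) = ⊝φ⁻¹<δ G≥ , [ w≤u⇒ , u<w⇒ ]′ (ℕₚ.≤-<-connex w u)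
  where
  w≤u⇒ : w ℕ.≤ u → δ u (w ℕ.+ z) <ᵣ ⊝ φ⁻³
  w≤u⇒ w≤u = δ<⊝φ⁻³ w z w≤u φ⁻¹<r
  u<w⇒ : u ℕ.< w → δ u (w ℕ.+ z) <ᵣ ⊝ φ⁻³
  u<w⇒ u<w = contradiction G<
    (<ᵣ-asym {fromℕ (suc u)} {φ⁻¹ ⊗ fromℕ (suc (w ℕ.+ z))} ([1+u]<φ⁻¹[v+1] w z u<w r<φ))

lemma8 : (u v : ℕ) → IsHofstadterGPair u v → (β : List Bool) → IsZeckendorf v β →
           head β ≡ just true →
           ((⊝ φ⁻¹) <ᵣ δ u v) × (δ u v <ᵣ (⊝ φ⁻³))
lemma8 u v (_ , _ , G) (true ∷ β) (refl , _ , nc) refl =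
  subst (λ v → IsG v u → δ u v ∈⟨ ⊝ φ⁻¹ , ⊝ φ⁻³ ⟩) (sym (fibSumFrom-+2 0 γ))
    (δ-∈ u (fibSumFrom 1 γ) (fibSumFrom 0 γ) r∈⟨φ⁻¹,φ⟩) G
  where
  γ = true ∷ β
  r∈⟨φ⁻¹,φ⟩ : fromℕ (fibSumFrom 1 γ) ⊖ φ ⊗ fromℕ (fibSumFrom 0 γ) ∈⟨ φ⁻¹ , φ ⟩
  r∈⟨φ⁻¹,φ⟩ = subst (_∈⟨ φ⁻¹ , φ ⟩) (ψSum≡fibSums γ) (ψSum-∈-true β nc)
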